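{- For a finite rooted tree $T$ with root $r$, let $C_T(x) = C_r(x)$ (defined in the context). Then $C_T$ is a complete invariant for rooted trees: for any two finite rooted trees $T$ and $T'$, $C_T(x) = C_{T'}(x)$ as polynomials if and only if $T$ and $T'$ are isomorphic as rooted trees (i.e., there is a graph isomorphism between them mapping the root of $T$ to the root of $T'$).
   Context: For a rooted tree $T$ and a vertex $v$, $T_v$ denotes the subtree rooted at $v$, consisting of $v$ and all its descendants, and $n_v$ denotes the number of vertices of $T_v$. A leaf is a vertex with no children. For each vertex $v$ with children $v_1,\dots,v_{\deg(v)}$, define inductively $C_v(x) = x+2$ if $v$ is a leaf, and $C_v(x) = x^{n_v} + 2x\prod_{i=1}^{\deg(v)} C_{v_i}(x) + 2$ if $v$ is an internal (non-leaf) vertex. (The product does not depend on the ordering of the children.) -}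

module Defs where

open import Data.Nat using (ℕ; zero; suc; _+_; _*_)
open import Data.List using (List; []; _∷_; length; replicate; _++_; lookup)
open import Data.Fin using (Fin)
open import Function.Bundles using (_↔_; Inverse)
open import Relation.Binary.PropositionalEquality using (_≡_)

-- The order of the list is irrelevant
-- for everything below (isomorphism ignores it, and so does C).

data Tree : Set where
  node : List Tree → Tree

mutual
  size : Tree → ℕ
  size (node cs) = suc (sizes cs)

  sizes : List Tree → ℕ
  sizes []       = 0
  sizes (c ∷ cs) = size c + sizes cs

-- Polynomials with natural-number coefficients, as coefficient lists
-- (constant term first).  Equality of polynomials is equality of all
-- coefficients (so trailing zeros are irrelevant).

Poly : Set
Poly = List ℕ

coeff : Poly → ℕ → ℕ
coeff []       _       = 0
coeff (a ∷ p)  zero    = a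
coeff (a ∷ p)  (suc i) = coeff p i

_≈P_ : Poly → Poly → Set
p ≈P q = ∀ i → coeff p i ≡ coeff q i

infixl 6 _+P_
infixl 7 _*P_

_+P_ : Poly → Poly → Poly
[]      +P q       = q
(a ∷ p) +P []      = a ∷ p
(a ∷ p) +P (b ∷ q) = (a + b) ∷ (p +P q)

scale : ℕ → Poly → Poly
scale c []      = []
scale c (a ∷ p) = (c * a) ∷ scale c p

_*P_ : Poly → Poly → Poly
[]      *P q = []
(a ∷ p) *P q = scale a q +P (0 ∷ (p *P q))

constP : ℕ → Poly
constP c = c ∷ []

xpow : ℕ → Poly
xpow n = replicate n 0 ++ (1 ∷ [])

X : Poly
X = xpow 1

mutual
  C : Tree → Poly
  C (node [])         = X +P constP 2
  C (node (c ∷ cs))   =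
    xpow (size (node (c ∷ cs))) +P (constP 2 *P X *P prodC (c ∷ cs)) +P constP 2

  prodC : List Tree → Poly
  prodC []       = constP 1
  prodC (c ∷ cs) = C c *P prodC cs

C-T : Tree → Poly
C-T = C

-- Isomorphism of rooted trees: a root-preserving graph isomorphism.
-- For trees given by their child-subtree lists this is: a bijection
-- between the children of the roots such that corresponding child
-- subtrees are (recursively) isomorphic as rooted trees.

data _≅_ : Tree → Tree → Set where
  iso : ∀ {cs ds} (σ : Fin (length cs) ↔ Fin (length ds)) →
        (∀ i → lookup cs i ≅ lookup ds (Inverse.to σ i)) →
        node cs ≅ node ds

module Submission where

-- Read in ℤ[X], every C_v is Eisenstein at 2 of degree n_v with constant term 2:
-- below the top, x^{n_v} contributes nothing and 2x∏C_{v_i} + 2 is even, while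
-- the leading coefficient is 1 or 1 + 2(…), hence odd.  Eisenstein polynomials
-- are prime in ℤ₍₂₎[X] (Euclid's algorithm there, plus Gauss's lemma modulo 2),
-- so a product of them determines its factors up to order and odd scalars, and
-- the constant term 2 removes the scalars.  As C_v determines n_v (its degree)
-- and therefore ∏ C_{v_i}, induction on the tree matches the children of any
-- two vertices with equal C up to a permutation.

open import Defs
open import Algebra.Bundles using (CommutativeRing)
open import Data.Empty using (⊥-elim)
open import Data.Fin using (Fin; zero; suc; punchIn)
open import Data.Fin.Permutation as Perm using (Permutation; _⟨$⟩ʳ_)
open import Data.Integer using (ℤ; +_; -[1+_]; 0ℤ; 1ℤ; _+_; _*_; -_; ∣_∣; ≢-nonZero)
open import Data.Integer.Divisibility.Signed
  using (_∣_; divides; _∣?_; ∣m∣n⇒∣m+n; ∣m+n∣m⇒∣n; ∣m+n∣n⇒∣m; ∣m⇒∣m*n; ∣n⇒∣m*n; ∣⇒∣ᵤ; ∣ᵤ⇒∣)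
import Data.Integer.Properties as ℤ
import Data.Integer.Tactic.RingSolver as ℤSolver
open import Data.List using (List; []; _∷_; [_]; length; lookup; map)
open import Data.Maybe using (Maybe; just; nothing)
open import Data.Nat as ℕ using (ℕ; zero; suc; _≤_; _<_; z≤n; s≤s)
import Data.Nat.Divisibility as ℕᵈ
open import Data.Nat.Induction using (<-wellFounded)
open import Data.Nat.Primality using (euclidsLemma; prime[2])
import Data.Nat.Properties as ℕₚ
open import Data.Product using (∃; ∃₂; Σ; _×_; _,_; proj₁; proj₂)
import Data.Product as Product
open import Data.Sum using (_⊎_; inj₁; inj₂; [_,_]′)
import Data.Sum as Sum
open import Data.Vec.Functional using (removeAt)
open import Function using (_∘_; id; _$_; case_of_)
open import Function.Bundles using (_↔_; Inverse)
open import Induction.WellFounded using (Acc; acc)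
open import Level using (0ℓ)
open import Relation.Binary.Bundles using (Setoid)
open import Relation.Binary.Definitions using (tri<; tri≈; tri>)
open import Relation.Binary.PropositionalEquality
  using (_≡_; _≢_; refl; sym; trans; cong; cong₂; subst; module ≡-Reasoning)
import Relation.Binary.Reasoning.Setoid as SetoidReasoning
open import Relation.Nullary using (¬_; yes; no; Dec)
open import Tactic.RingSolver using (solve-∀)
open import Tactic.RingSolver.Core.AlmostCommutativeRing
  using (AlmostCommutativeRing; fromCommutativeRing)

ℤ[X] : Set
ℤ[X] = List ℤ

coeffℤ : ℤ[X] → ℕ → ℤ
coeffℤ []      _       = 0ℤ
coeffℤ (a ∷ p) zero    = a
coeffℤ (a ∷ p) (suc i) = coeffℤ p i

infix  8 ⊖_
infixl 7 _·_ _⊗_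
infixl 6 _⊕_
infix  4 _≈_

_⊕_ : ℤ[X] → ℤ[X] → ℤ[X]
[]      ⊕ q       = q
(a ∷ p) ⊕ []      = a ∷ p
(a ∷ p) ⊕ (b ∷ q) = a + b ∷ p ⊕ q

_·_ : ℤ → ℤ[X] → ℤ[X]
c · p = map (c *_) p

⊖_ : ℤ[X] → ℤ[X]
⊖_ = map -_

_⊗_ : ℤ[X] → ℤ[X] → ℤ[X]
[]      ⊗ q = []
(a ∷ p) ⊗ q = a · q ⊕ (0ℤ ∷ p ⊗ q)

record _≈_ (p q : ℤ[X]) : Set where
  constructor coeffwise
  field coeff-≡ : ∀ i → coeffℤ p i ≡ coeffℤ q i
open _≈_ public

≈-refl : ∀ {p} → p ≈ p
≈-refl = coeffwise λ _ → refl

≈-sym : ∀ {p q} → p ≈ q → q ≈ p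
≈-sym e = coeffwise λ i → sym (coeff-≡ e i)

≈-trans : ∀ {p q r} → p ≈ q → q ≈ r → p ≈ r
≈-trans e f = coeffwise λ i → trans (coeff-≡ e i) (coeff-≡ f i)

≈-reflexive : ∀ {p q} → p ≡ q → p ≈ q
≈-reflexive refl = ≈-refl

≈-setoid : Setoid 0ℓ 0ℓ
≈-setoid = record
  { Carrier = ℤ[X] ; _≈_ = _≈_
  ; isEquivalence = record { refl = ≈-refl ; sym = ≈-sym ; trans = ≈-trans } }

module ≈-Reasoning = SetoidReasoning ≈-setoid

∷-cong : ∀ {a b p q} → a ≡ b → p ≈ q → a ∷ p ≈ b ∷ q
∷-cong a≡b p≈q = coeffwise λ { zero → a≡b ; (suc i) → coeff-≡ p≈q i }

∷-injectiveʳ : ∀ {a b p q} → a ∷ p ≈ b ∷ q → p ≈ q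
∷-injectiveʳ e = coeffwise (coeff-≡ e ∘ suc)

∷-zero⁻ : ∀ {a p} → a ∷ p ≈ [] → p ≈ []
∷-zero⁻ e = coeffwise (coeff-≡ e ∘ suc)

∷-zero : ∀ {a p} → a ≡ 0ℤ → p ≈ [] → a ∷ p ≈ []
∷-zero a≡0 p≈0 = coeffwise λ { zero → a≡0 ; (suc i) → coeff-≡ p≈0 i }

coeff-⊕ : ∀ p q i → coeffℤ (p ⊕ q) i ≡ coeffℤ p i + coeffℤ q i
coeff-⊕ []      q       i       = sym (ℤ.+-identityˡ _)
coeff-⊕ (a ∷ p) []      i       = sym (ℤ.+-identityʳ _)
coeff-⊕ (a ∷ p) (b ∷ q) zero    = refl
coeff-⊕ (a ∷ p) (b ∷ q) (suc i) = coeff-⊕ p q i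

coeff-map : ∀ {f} → f 0ℤ ≡ 0ℤ → ∀ p i → coeffℤ (map f p) i ≡ f (coeffℤ p i)
coeff-map f0 []      i       = sym f0
coeff-map f0 (a ∷ p) zero    = refl
coeff-map f0 (a ∷ p) (suc i) = coeff-map f0 p i

coeff-· : ∀ c p i → coeffℤ (c · p) i ≡ c * coeffℤ p i
coeff-· c = coeff-map (ℤ.*-zeroʳ c)

coeff-⊖ : ∀ p i → coeffℤ (⊖ p) i ≡ - coeffℤ p i
coeff-⊖ = coeff-map refl

⊕-cong : ∀ {p p′ q q′} → p ≈ p′ → q ≈ q′ → p ⊕ q ≈ p′ ⊕ q′
⊕-cong {p} {p′} {q} {q′} e f = coeffwise λ i → begin
  coeffℤ (p ⊕ q) i            ≡⟨ coeff-⊕ p q i ⟩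
  coeffℤ p i + coeffℤ q i     ≡⟨ cong₂ _+_ (coeff-≡ e i) (coeff-≡ f i) ⟩
  coeffℤ p′ i + coeffℤ q′ i   ≡⟨ coeff-⊕ p′ q′ i ⟨
  coeffℤ (p′ ⊕ q′) i          ∎
  where open ≡-Reasoning

⊕-comm : ∀ p q → p ⊕ q ≈ q ⊕ p
⊕-comm p q = coeffwise λ i → begin
  coeffℤ (p ⊕ q) i         ≡⟨ coeff-⊕ p q i ⟩
  coeffℤ p i + coeffℤ q i  ≡⟨ ℤ.+-comm (coeffℤ p i) (coeffℤ q i) ⟩
  coeffℤ q i + coeffℤ p i  ≡⟨ coeff-⊕ q p i ⟨
  coeffℤ (q ⊕ p) i         ∎
  where open ≡-Reasoning

⊕-assoc : ∀ p q r → p ⊕ q ⊕ r ≈ p ⊕ (q ⊕ r)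
⊕-assoc p q r = coeffwise λ i → begin
  coeffℤ (p ⊕ q ⊕ r) i                      ≡⟨ coeff-⊕ (p ⊕ q) r i ⟩
  coeffℤ (p ⊕ q) i + coeffℤ r i             ≡⟨ cong (_+ coeffℤ r i) (coeff-⊕ p q i) ⟩
  coeffℤ p i + coeffℤ q i + coeffℤ r i      ≡⟨ ℤ.+-assoc (coeffℤ p i) (coeffℤ q i) (coeffℤ r i) ⟩
  coeffℤ p i + (coeffℤ q i + coeffℤ r i)    ≡⟨ cong (λ z → coeffℤ p i + z) (coeff-⊕ q r i) ⟨
  coeffℤ p i + coeffℤ (q ⊕ r) i             ≡⟨ coeff-⊕ p (q ⊕ r) i ⟨
  coeffℤ (p ⊕ (q ⊕ r)) i                    ∎
  where open ≡-Reasoning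

⊕-identityʳ : ∀ p → p ⊕ [] ≈ p
⊕-identityʳ p = coeffwise λ i → trans (coeff-⊕ p [] i) (ℤ.+-identityʳ _)

⊕-inverseʳ : ∀ p → p ⊕ ⊖ p ≈ []
⊕-inverseʳ p = coeffwise λ i → begin
  coeffℤ (p ⊕ ⊖ p) i          ≡⟨ coeff-⊕ p (⊖ p) i ⟩
  coeffℤ p i + coeffℤ (⊖ p) i ≡⟨ cong (λ z → coeffℤ p i + z) (coeff-⊖ p i) ⟩
  coeffℤ p i + - coeffℤ p i   ≡⟨ ℤ.+-inverseʳ (coeffℤ p i) ⟩
  0ℤ                          ∎
  where open ≡-Reasoning

⊕-leftComm : ∀ p q r → p ⊕ (q ⊕ r) ≈ q ⊕ (p ⊕ r)
⊕-leftComm p q r = begin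
  p ⊕ (q ⊕ r) ≈⟨ ⊕-assoc p q r ⟨
  p ⊕ q ⊕ r   ≈⟨ ⊕-cong (⊕-comm p q) ≈-refl ⟩
  q ⊕ p ⊕ r   ≈⟨ ⊕-assoc q p r ⟩
  q ⊕ (p ⊕ r) ∎
  where open ≈-Reasoning

⊕-interchange : ∀ p q r s → (p ⊕ q) ⊕ (r ⊕ s) ≈ (p ⊕ r) ⊕ (q ⊕ s)
⊕-interchange p q r s = begin
  p ⊕ q ⊕ (r ⊕ s)   ≈⟨ ⊕-assoc p q (r ⊕ s) ⟩
  p ⊕ (q ⊕ (r ⊕ s)) ≈⟨ ⊕-cong (≈-refl {p}) (⊕-leftComm q r s) ⟩
  p ⊕ (r ⊕ (q ⊕ s)) ≈⟨ ⊕-assoc p r (q ⊕ s) ⟨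
  p ⊕ r ⊕ (q ⊕ s)   ∎
  where open ≈-Reasoning

⊖-cong : ∀ {p q} → p ≈ q → ⊖ p ≈ ⊖ q
⊖-cong {p} {q} e = coeffwise λ i →
  trans (coeff-⊖ p i) (trans (cong -_ (coeff-≡ e i)) (sym (coeff-⊖ q i)))

·-zeroˡ : ∀ p → 0ℤ · p ≈ []
·-zeroˡ p = coeffwise λ i → coeff-· 0ℤ p i

·-identityˡ : ∀ p → 1ℤ · p ≈ p
·-identityˡ p = coeffwise λ i → trans (coeff-· 1ℤ p i) (ℤ.*-identityˡ _)

·-distribˡ-⊕ : ∀ c p q → c · (p ⊕ q) ≈ c · p ⊕ c · q
·-distribˡ-⊕ c p q = coeffwise λ i → begin
  coeffℤ (c · (p ⊕ q)) i                ≡⟨ coeff-· c (p ⊕ q) i ⟩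
  c * coeffℤ (p ⊕ q) i                  ≡⟨ cong (c *_) (coeff-⊕ p q i) ⟩
  c * (coeffℤ p i + coeffℤ q i)         ≡⟨ ℤ.*-distribˡ-+ c (coeffℤ p i) (coeffℤ q i) ⟩
  c * coeffℤ p i + c * coeffℤ q i       ≡⟨ cong₂ _+_ (coeff-· c p i) (coeff-· c q i) ⟨
  coeffℤ (c · p) i + coeffℤ (c · q) i   ≡⟨ coeff-⊕ (c · p) (c · q) i ⟨
  coeffℤ (c · p ⊕ c · q) i              ∎
  where open ≡-Reasoning

·-distribʳ-+ : ∀ a b p → (a + b) · p ≈ a · p ⊕ b · p
·-distribʳ-+ a b p = coeffwise λ i → begin
  coeffℤ ((a + b) · p) i                ≡⟨ coeff-· (a + b) p i ⟩
  (a + b) * coeffℤ p i                  ≡⟨ ℤ.*-distribʳ-+ (coeffℤ p i) a b ⟩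
  a * coeffℤ p i + b * coeffℤ p i       ≡⟨ cong₂ _+_ (coeff-· a p i) (coeff-· b p i) ⟨
  coeffℤ (a · p) i + coeffℤ (b · p) i   ≡⟨ coeff-⊕ (a · p) (b · p) i ⟨
  coeffℤ (a · p ⊕ b · p) i              ∎
  where open ≡-Reasoning

·-assoc : ∀ a b p → (a * b) · p ≈ a · (b · p)
·-assoc a b p = coeffwise λ i → begin
  coeffℤ ((a * b) · p) i   ≡⟨ coeff-· (a * b) p i ⟩
  a * b * coeffℤ p i       ≡⟨ ℤ.*-assoc a b (coeffℤ p i) ⟩
  a * (b * coeffℤ p i)     ≡⟨ cong (a *_) (coeff-· b p i) ⟨
  a * coeffℤ (b · p) i     ≡⟨ coeff-· a (b · p) i ⟨
  coeffℤ (a · (b · p)) i   ∎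
  where open ≡-Reasoning

⊗-zeroʳ : ∀ p → p ⊗ [] ≈ []
⊗-zeroʳ []      = ≈-refl
⊗-zeroʳ (a ∷ p) = ∷-zero refl (⊗-zeroʳ p)

⊗-zeroˡ : ∀ {p} q → p ≈ [] → p ⊗ q ≈ []
⊗-zeroˡ {[]}    q _   = ≈-refl
⊗-zeroˡ {a ∷ p} q a∷p≈0 = begin
  a · q ⊕ (0ℤ ∷ p ⊗ q) ≈⟨ ⊕-cong (≈-reflexive (cong (_· q) (coeff-≡ a∷p≈0 0)))
                                  (∷-zero refl (⊗-zeroˡ q (∷-zero⁻ a∷p≈0))) ⟩
  0ℤ · q ⊕ []          ≈⟨ ⊕-identityʳ (0ℤ · q) ⟩
  0ℤ · q               ≈⟨ ·-zeroˡ q ⟩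
  []                   ∎
  where open ≈-Reasoning

⊗-congˡ : ∀ {p p′} q → p ≈ p′ → p ⊗ q ≈ p′ ⊗ q
⊗-congˡ {[]}    {p′}     q e = ≈-sym (⊗-zeroˡ q (≈-sym e))
⊗-congˡ {a ∷ p} {[]}     q e = ⊗-zeroˡ q e
⊗-congˡ {a ∷ p} {b ∷ p′} q e =
  ⊕-cong (≈-reflexive (cong (_· q) (coeff-≡ e 0)))
         (∷-cong refl (⊗-congˡ q (∷-injectiveʳ e)))

⊗-∷ʳ : ∀ p b q → p ⊗ (b ∷ q) ≈ b · p ⊕ (0ℤ ∷ p ⊗ q)
⊗-∷ʳ []      b q = ≈-sym (∷-zero refl ≈-refl)
⊗-∷ʳ (a ∷ p) b q = ∷-cong (cong (_+ 0ℤ) (ℤ.*-comm a b)) (begin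
  a · q ⊕ p ⊗ (b ∷ q)                ≈⟨ ⊕-cong ≈-refl (⊗-∷ʳ p b q) ⟩
  a · q ⊕ (b · p ⊕ (0ℤ ∷ p ⊗ q))     ≈⟨ ⊕-leftComm (a · q) (b · p) (0ℤ ∷ p ⊗ q) ⟩
  b · p ⊕ (a · q ⊕ (0ℤ ∷ p ⊗ q))     ∎)
  where open ≈-Reasoning

⊗-comm : ∀ p q → p ⊗ q ≈ q ⊗ p
⊗-comm []      q = ≈-sym (⊗-zeroʳ q)
⊗-comm (a ∷ p) q = ≈-trans (⊕-cong ≈-refl (∷-cong refl (⊗-comm p q))) (≈-sym (⊗-∷ʳ q a p))

⊗-distribʳ : ∀ p q r → (p ⊕ q) ⊗ r ≈ p ⊗ r ⊕ q ⊗ r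
⊗-distribʳ []      q       r = ≈-refl
⊗-distribʳ (a ∷ p) []      r = ≈-sym (⊕-identityʳ _)
⊗-distribʳ (a ∷ p) (b ∷ q) r = begin
  (a + b) · r ⊕ (0ℤ ∷ (p ⊕ q) ⊗ r)
    ≈⟨ ⊕-cong (·-distribʳ-+ a b r) (∷-cong refl (⊗-distribʳ p q r)) ⟩
  a · r ⊕ b · r ⊕ ((0ℤ ∷ p ⊗ r) ⊕ (0ℤ ∷ q ⊗ r))
    ≈⟨ ⊕-interchange (a · r) (b · r) (0ℤ ∷ p ⊗ r) (0ℤ ∷ q ⊗ r) ⟩
  a · r ⊕ (0ℤ ∷ p ⊗ r) ⊕ (b · r ⊕ (0ℤ ∷ q ⊗ r))
    ∎
  where open ≈-Reasoning

·-⊗ : ∀ c p q → (c · p) ⊗ q ≈ c · (p ⊗ q)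
·-⊗ c []      q = ≈-refl
·-⊗ c (a ∷ p) q = begin
  (c * a) · q ⊕ (0ℤ ∷ (c · p) ⊗ q)   ≈⟨ ⊕-cong (·-assoc c a q) (∷-cong (sym (ℤ.*-zeroʳ c)) (·-⊗ c p q)) ⟩
  c · (a · q) ⊕ c · (0ℤ ∷ p ⊗ q)     ≈⟨ ·-distribˡ-⊕ c (a · q) (0ℤ ∷ p ⊗ q) ⟨
  c · (a · q ⊕ (0ℤ ∷ p ⊗ q))         ∎
  where open ≈-Reasoning

⊗-assoc : ∀ p q r → p ⊗ q ⊗ r ≈ p ⊗ (q ⊗ r)
⊗-assoc []      q r = ≈-refl
⊗-assoc (a ∷ p) q r = begin
  (a · q ⊕ (0ℤ ∷ p ⊗ q)) ⊗ r
    ≈⟨ ⊗-distribʳ (a · q) (0ℤ ∷ p ⊗ q) r ⟩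
  (a · q) ⊗ r ⊕ (0ℤ · r ⊕ (0ℤ ∷ p ⊗ q ⊗ r))
    ≈⟨ ⊕-cong (·-⊗ a q r) (⊕-cong (·-zeroˡ r) (∷-cong refl (⊗-assoc p q r))) ⟩
  a · (q ⊗ r) ⊕ (0ℤ ∷ p ⊗ (q ⊗ r))
    ∎
  where open ≈-Reasoning

⊗-identityˡ : ∀ p → [ 1ℤ ] ⊗ p ≈ p
⊗-identityˡ p = ≈-trans (⊕-cong (·-identityˡ p) (∷-zero refl ≈-refl)) (⊕-identityʳ p)

⊗-congʳ : ∀ p {q q′} → q ≈ q′ → p ⊗ q ≈ p ⊗ q′
⊗-congʳ p {q} {q′} e = ≈-trans (⊗-comm p q) (≈-trans (⊗-congˡ p e) (⊗-comm q′ p))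

ℤ[X]-commutativeRing : CommutativeRing 0ℓ 0ℓ
ℤ[X]-commutativeRing = record
  { Carrier = ℤ[X] ; _≈_ = _≈_ ; _+_ = _⊕_ ; _*_ = _⊗_ ; -_ = ⊖_ ; 0# = [] ; 1# = [ 1ℤ ]
  ; isCommutativeRing = record
    { isRing = record
      { +-isAbelianGroup = record
        { isGroup = record
          { isMonoid = record
            { isSemigroup = record
              { isMagma = record
                { isEquivalence = Setoid.isEquivalence ≈-setoid
                ; ∙-cong = ⊕-cong }
              ; assoc = ⊕-assoc }
            ; identity = (λ _ → ≈-refl) , ⊕-identityʳ }
          ; inverse = (λ p → ≈-trans (⊕-comm (⊖ p) p) (⊕-inverseʳ p)) , ⊕-inverseʳ
          ; ⁻¹-cong = ⊖-cong }
        ; comm = ⊕-comm }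
      ; *-cong = λ {p} {p′} {q} e f → ≈-trans (⊗-congˡ q e) (⊗-congʳ p′ f)
      ; *-assoc = ⊗-assoc
      ; *-identity = ⊗-identityˡ , λ p → ≈-trans (⊗-comm p [ 1ℤ ]) (⊗-identityˡ p)
      ; distrib = (λ p q r → ≈-trans (⊗-comm p (q ⊕ r))
                    (≈-trans (⊗-distribʳ q r p) (⊕-cong (⊗-comm q p) (⊗-comm r p))))
                , (λ r p q → ⊗-distribʳ p q r) }
    ; *-comm = ⊗-comm } }

-- The solver cancels terms only if it can recognise the zero constants
-- [0], [0,0], … that its own normalisation produces.
≈-zero? : ∀ p → Maybe ([] ≈ p)
≈-zero? [] = just ≈-refl
≈-zero? (+ 0 ∷ p) with ≈-zero? p
... | just 0≈p = just (≈-sym (∷-zero refl (≈-sym 0≈p)))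
... | nothing  = nothing
≈-zero? (_ ∷ p) = nothing

ℤ[X]-almostCommutativeRing : AlmostCommutativeRing 0ℓ 0ℓ
ℤ[X]-almostCommutativeRing = fromCommutativeRing ℤ[X]-commutativeRing ≈-zero?

⊗-leftComm : ∀ p q r → p ⊗ (q ⊗ r) ≈ q ⊗ (p ⊗ r)
⊗-leftComm = solve-∀ ℤ[X]-almostCommutativeRing

coeff-∷⊗-zero : ∀ a p q → coeffℤ ((a ∷ p) ⊗ q) 0 ≡ a * coeffℤ q 0
coeff-∷⊗-zero a p q =
  trans (coeff-⊕ (a · q) (0ℤ ∷ p ⊗ q) 0) (trans (ℤ.+-identityʳ _) (coeff-· a q 0))

coeff-∷⊗-suc : ∀ a p q i → coeffℤ ((a ∷ p) ⊗ q) (suc i) ≡ a * coeffℤ q (suc i) + coeffℤ (p ⊗ q) i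
coeff-∷⊗-suc a p q i =
  trans (coeff-⊕ (a · q) (0ℤ ∷ p ⊗ q) (suc i)) (cong (_+ coeffℤ (p ⊗ q) i) (coeff-· a q (suc i)))

coeff-⊗-zero : ∀ p q → coeffℤ (p ⊗ q) 0 ≡ coeffℤ p 0 * coeffℤ q 0
coeff-⊗-zero []      q = sym (ℤ.*-zeroˡ (coeffℤ q 0))
coeff-⊗-zero (a ∷ p) q = coeff-∷⊗-zero a p q

[]⊗≈· : ∀ c p → [ c ] ⊗ p ≈ c · p
[]⊗≈· c p = ≈-trans (⊕-cong ≈-refl (∷-zero refl ≈-refl)) (⊕-identityʳ (c · p))

coeff-[]⊗ : ∀ c p i → coeffℤ ([ c ] ⊗ p) i ≡ c * coeffℤ p i
coeff-[]⊗ c p i = trans (coeff-≡ ([]⊗≈· c p) i) (coeff-· c p i)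

[]-* : ∀ a b → [ a * b ] ≈ [ a ] ⊗ [ b ]
[]-* a b = coeffwise λ
  { zero    → sym (coeff-[]⊗ a [ b ] 0)
  ; (suc i) → sym (trans (coeff-[]⊗ a [ b ] (suc i)) (ℤ.*-zeroʳ a)) }

[]⊗-cancel : ∀ c {p q} → c ≢ 0ℤ → [ c ] ⊗ p ≈ [ c ] ⊗ q → p ≈ q
[]⊗-cancel c {p} {q} c≢0 e = coeffwise λ i →
  ℤ.*-cancelˡ-≡ c _ _ {{≢-nonZero c≢0}}
    (trans (sym (coeff-[]⊗ c p i)) (trans (coeff-≡ e i) (coeff-[]⊗ c q i)))

*-≢0 : ∀ {a b} → a ≢ 0ℤ → b ≢ 0ℤ → a * b ≢ 0ℤ
*-≢0 {a} a≢0 b≢0 ab≡0 = [ a≢0 , b≢0 ]′ (ℤ.i*j≡0⇒i≡0∨j≡0 a ab≡0)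

record DegreeBelow (p : ℤ[X]) (n : ℕ) : Set where
  constructor vanishing
  field vanishes : ∀ i → n ≤ i → coeffℤ p i ≡ 0ℤ
open DegreeBelow public

record HasDegree (p : ℤ[X]) (n : ℕ) : Set where
  constructor hasDegree
  field
    leading≢0 : coeffℤ p n ≢ 0ℤ
    below     : DegreeBelow p (suc n)
open HasDegree public

DegreeBelow-[] : ∀ {n} → DegreeBelow [] n
DegreeBelow-[] = vanishing λ _ _ → refl

DegreeBelow-resp-≈ : ∀ {p q n} → p ≈ q → DegreeBelow p n → DegreeBelow q n
DegreeBelow-resp-≈ p≈q bp = vanishing λ i n≤i → trans (sym (coeff-≡ p≈q i)) (vanishes bp i n≤i)

HasDegree-resp-≈ : ∀ {p q n} → p ≈ q → HasDegree p n → HasDegree q n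
HasDegree-resp-≈ {n = n} p≈q (hasDegree lc bp) =
  hasDegree (lc ∘ trans (coeff-≡ p≈q n)) (DegreeBelow-resp-≈ p≈q bp)

DegreeBelow-zero : ∀ {p} → DegreeBelow p 0 → p ≈ []
DegreeBelow-zero bp = coeffwise λ i → vanishes bp i z≤n

DegreeBelow-∷ : ∀ {a p n} → DegreeBelow (a ∷ p) (suc n) → DegreeBelow p n
DegreeBelow-∷ bp = vanishing λ i n≤i → vanishes bp (suc i) (s≤s n≤i)

length-degreeBelow : ∀ p → DegreeBelow p (length p)
length-degreeBelow []      = DegreeBelow-[]
length-degreeBelow (a ∷ p) = vanishing λ { (suc i) (s≤s le) → vanishes (length-degreeBelow p) i le }

HasDegree-≉0 : ∀ {p n} → HasDegree p n → ¬ p ≈ []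
HasDegree-≉0 {n = n} hp p≈0 = leading≢0 hp (coeff-≡ p≈0 n)

degree? : ∀ p → p ≈ [] ⊎ ∃ (HasDegree p)
degree? [] = inj₁ ≈-refl
degree? (a ∷ p) with degree? p
... | inj₂ (n , hasDegree lc bp) =
  inj₂ (suc n , hasDegree lc (vanishing λ { (suc i) (s≤s le) → vanishes bp i le }))
... | inj₁ p≈0 with a ℤ.≟ 0ℤ
...   | yes a≡0 = inj₁ (∷-zero a≡0 p≈0)
...   | no  a≢0 = inj₂ (0 , hasDegree a≢0 (vanishing λ { (suc i) _ → coeff-≡ p≈0 i }))

HasDegree-unique : ∀ {p m n} → HasDegree p m → HasDegree p n → m ≡ n
HasDegree-unique {m = m} {n} hm hn with ℕₚ.<-cmp m n
... | tri< m<n _ _ = ⊥-elim (leading≢0 hn (vanishes (below hm) n m<n))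
... | tri≈ _ m≡n _ = m≡n
... | tri> _ _ n<m = ⊥-elim (leading≢0 hm (vanishes (below hn) m n<m))

HasDegree⇒< : ∀ {p m n} → DegreeBelow p m → HasDegree p n → n < m
HasDegree⇒< {n = n} bp hp = ℕₚ.≰⇒> λ m≤n → leading≢0 hp (vanishes bp n m≤n)

⊗-degreeBelow : ∀ {p q m n} → DegreeBelow p m → DegreeBelow q (suc n) → DegreeBelow (p ⊗ q) (m ℕ.+ n)
⊗-degreeBelow {[]}                    _  _  = DegreeBelow-[]
⊗-degreeBelow {a ∷ p} {q} {zero}      bp _  =
  DegreeBelow-resp-≈ (≈-sym (⊗-zeroˡ q (DegreeBelow-zero bp))) DegreeBelow-[]
⊗-degreeBelow {a ∷ p} {q} {suc m} {n} bp bq = vanishing λ { (suc i) (s≤s le) → begin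
  coeffℤ ((a ∷ p) ⊗ q) (suc i)                  ≡⟨ coeff-∷⊗-suc a p q i ⟩
  a * coeffℤ q (suc i) + coeffℤ (p ⊗ q) i       ≡⟨ cong₂ (λ x y → a * x + y)
                                                     (vanishes bq (suc i) (s≤s (ℕₚ.≤-trans (ℕₚ.m≤n+m n m) le)))
                                                     (vanishes (⊗-degreeBelow (DegreeBelow-∷ bp) bq) i le) ⟩
  a * 0ℤ + 0ℤ                                   ≡⟨ cong (_+ 0ℤ) (ℤ.*-zeroʳ a) ⟩
  0ℤ                                            ∎ }
  where open ≡-Reasoning

coeff-⊗-top : ∀ {p q m n} → DegreeBelow p (suc m) → DegreeBelow q (suc n) →
              coeffℤ (p ⊗ q) (m ℕ.+ n) ≡ coeffℤ p m * coeffℤ q n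
coeff-⊗-top {[]} {q} {n = n}          _  _  = sym (ℤ.*-zeroˡ (coeffℤ q n))
coeff-⊗-top {a ∷ p} {q} {zero}  {n}  bp bq = begin
  coeffℤ (a · q ⊕ (0ℤ ∷ p ⊗ q)) n              ≡⟨ coeff-⊕ (a · q) (0ℤ ∷ p ⊗ q) n ⟩
  coeffℤ (a · q) n + coeffℤ (0ℤ ∷ p ⊗ q) n     ≡⟨ cong₂ _+_ (coeff-· a q n) (coeff-≡ p⊗q≈0 n) ⟩
  a * coeffℤ q n + 0ℤ                          ≡⟨ ℤ.+-identityʳ _ ⟩
  a * coeffℤ q n                               ∎
  where
  open ≡-Reasoning
  p⊗q≈0 : 0ℤ ∷ p ⊗ q ≈ []
  p⊗q≈0 = ∷-zero refl (⊗-zeroˡ q (DegreeBelow-zero (DegreeBelow-∷ bp)))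
coeff-⊗-top {a ∷ p} {q} {suc m} {n} bp bq = begin
  coeffℤ ((a ∷ p) ⊗ q) (suc (m ℕ.+ n))                 ≡⟨ coeff-∷⊗-suc a p q (m ℕ.+ n) ⟩
  a * coeffℤ q (suc (m ℕ.+ n)) + coeffℤ (p ⊗ q) (m ℕ.+ n) ≡⟨ cong₂ (λ x y → a * x + y)
                                                           (vanishes bq _ (s≤s (ℕₚ.m≤n+m n m)))
                                                           (coeff-⊗-top (DegreeBelow-∷ bp) bq) ⟩
  a * 0ℤ + coeffℤ p m * coeffℤ q n                       ≡⟨ cong (_+ coeffℤ p m * coeffℤ q n) (ℤ.*-zeroʳ a) ⟩
  0ℤ + coeffℤ p m * coeffℤ q n                           ≡⟨ ℤ.+-identityˡ _ ⟩
  coeffℤ p m * coeffℤ q n                                ∎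
  where open ≡-Reasoning

HasDegree-⊗ : ∀ {p q m n} → HasDegree p m → HasDegree q n → HasDegree (p ⊗ q) (m ℕ.+ n)
HasDegree-⊗ {p} {q} {m} {n} hp hq = hasDegree
  (λ top≡0 → *-≢0 (leading≢0 hp) (leading≢0 hq) (trans (sym (coeff-⊗-top (below hp) (below hq))) top≡0))
  (⊗-degreeBelow (below hp) (below hq))

⊗-cancelˡ : ∀ {p q r n} → HasDegree p n → p ⊗ q ≈ p ⊗ r → q ≈ r
⊗-cancelˡ {p} {q} {r} hp e with degree? (q ⊕ ⊖ r)
... | inj₁ q-r≈0 = ≈-trans (split q r) (≈-trans (⊕-cong q-r≈0 ≈-refl) ≈-refl)
  where
  split : ∀ q r → q ≈ q ⊕ ⊖ r ⊕ r
  split = solve-∀ ℤ[X]-almostCommutativeRing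
... | inj₂ (_ , hq-r) = ⊥-elim (HasDegree-≉0 (HasDegree-⊗ hp hq-r) p⊗[q-r]≈0)
  where
  expand : ∀ p q r → p ⊗ (q ⊕ ⊖ r) ≈ p ⊗ q ⊕ ⊖ (p ⊗ r)
  expand = solve-∀ ℤ[X]-almostCommutativeRing
  p⊗[q-r]≈0 : p ⊗ (q ⊕ ⊖ r) ≈ []
  p⊗[q-r]≈0 = ≈-trans (expand p q r) (≈-trans (⊕-cong e ≈-refl) (⊕-inverseʳ (p ⊗ r)))

cofactor-degree : ∀ {p m n} f u → HasDegree p m → HasDegree f n → p ≈ f ⊗ u →
                  ∃ λ k → HasDegree u k × m ≡ n ℕ.+ k
cofactor-degree f u hp hf p≈fu with degree? u
... | inj₁ u≈0      = ⊥-elim (HasDegree-≉0 hp (≈-trans p≈fu (≈-trans (⊗-congʳ f u≈0) (⊗-zeroʳ f))))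
... | inj₂ (k , hu) = k , hu , HasDegree-unique (HasDegree-resp-≈ p≈fu hp) (HasDegree-⊗ hf hu)

[]-hasDegree : ∀ {c} → c ≢ 0ℤ → HasDegree [ c ] 0
[]-hasDegree c≢0 = hasDegree c≢0 (vanishing λ { (suc i) _ → refl })

HasDegree-[]⊗⁻ : ∀ c {p n} → c ≢ 0ℤ → HasDegree ([ c ] ⊗ p) n → HasDegree p n
HasDegree-[]⊗⁻ c {p} {n} c≢0 (hasDegree lc bp) = hasDegree
  (λ pn≡0 → lc (trans (coeff-[]⊗ c p n) (trans (cong (c *_) pn≡0) (ℤ.*-zeroʳ c))))
  (vanishing λ i le → [ ⊥-elim ∘ c≢0 , id ]′
    (ℤ.i*j≡0⇒i≡0∨j≡0 c (trans (sym (coeff-[]⊗ c p i)) (vanishes bp i le))))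

HasDegree-zero : ∀ {p} → HasDegree p 0 → p ≈ [ coeffℤ p 0 ]
HasDegree-zero hp = coeffwise λ { zero → refl ; (suc i) → vanishes (below hp) (suc i) (s≤s z≤n) }

DegreeBelow-⊕ : ∀ {p q n} → DegreeBelow p n → DegreeBelow q n → DegreeBelow (p ⊕ q) n
DegreeBelow-⊕ {p} {q} bp bq = vanishing λ i le →
  trans (coeff-⊕ p q i) (cong₂ _+_ (vanishes bp i le) (vanishes bq i le))

DegreeBelow-⊖ : ∀ {p n} → DegreeBelow p n → DegreeBelow (⊖ p) n
DegreeBelow-⊖ {p} bp = vanishing λ i le → trans (coeff-⊖ p i) (cong -_ (vanishes bp i le))

DegreeBelow-pred : ∀ {p n} → DegreeBelow p (suc n) → coeffℤ p n ≡ 0ℤ → DegreeBelow p n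
DegreeBelow-pred {p} {n} bp pn≡0 = vanishing λ i n≤i → case (ℕₚ.m≤n⇒m<n∨m≡n n≤i)
  where
  case : ∀ {i} → n < i ⊎ n ≡ i → coeffℤ p i ≡ 0ℤ
  case (inj₁ n<i) = vanishes bp _ n<i
  case (inj₂ refl) = pn≡0

[]-degreeBelow : ∀ c → DegreeBelow [ c ] 1
[]-degreeBelow c = vanishing λ { (suc i) _ → refl }

infix 8 x^_

x^_ : ℕ → ℤ[X]
x^ zero  = [ 1ℤ ]
x^ suc n = 0ℤ ∷ x^ n

coeff-x^-≡ : ∀ n → coeffℤ (x^ n) n ≡ 1ℤ
coeff-x^-≡ zero    = refl
coeff-x^-≡ (suc n) = coeff-x^-≡ n

coeff-x^-< : ∀ {n i} → i < n → coeffℤ (x^ n) i ≡ 0ℤ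
coeff-x^-< {suc n} {zero}  _         = refl
coeff-x^-< {suc n} {suc i} (s≤s i<n) = coeff-x^-< i<n

x^-degreeBelow : ∀ n → DegreeBelow (x^ n) (suc n)
x^-degreeBelow zero    = []-degreeBelow 1ℤ
x^-degreeBelow (suc n) = vanishing λ { (suc i) (s≤s le) → vanishes (x^-degreeBelow n) i le }

DegreeBelow-mono : ∀ {p m n} → m ≤ n → DegreeBelow p m → DegreeBelow p n
DegreeBelow-mono m≤n bp = vanishing λ i n≤i → vanishes bp i (ℕₚ.≤-trans m≤n n≤i)

x^-hasDegree : ∀ n → HasDegree (x^ n) n
x^-hasDegree n = hasDegree (λ xⁿ≡0 → case trans (sym (coeff-x^-≡ n)) xⁿ≡0 of λ ()) (x^-degreeBelow n)

Even : ℤ → Set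
Even x = + 2 ∣ x

Odd : ℤ → Set
Odd x = ¬ Even x

even? : ∀ x → Dec (Even x)
even? x = + 2 ∣? x

even-0 : Even 0ℤ
even-0 = divides 0ℤ refl

even-*ˡ : ∀ {a} b → Even a → Even (a * b)
even-*ˡ b = ∣m⇒∣m*n b

even-*ʳ : ∀ a {b} → Even b → Even (a * b)
even-*ʳ a = ∣n⇒∣m*n a

even-2 : Even (+ 2)
even-2 = divides 1ℤ refl

even-2* : ∀ x → Even (+ 2 * x)
even-2* x = even-*ˡ x even-2

even-+ : ∀ {a b} → Even a → Even b → Even (a + b)
even-+ = ∣m∣n⇒∣m+n

even-+-cancelˡ : ∀ {a b} → Even (a + b) → Even a → Even b
even-+-cancelˡ = ∣m+n∣m⇒∣n

even-* : ∀ a b → Even (a * b) → Even a ⊎ Even b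
even-* a b 2∣ab = Sum.map ∣ᵤ⇒∣ ∣ᵤ⇒∣
  (euclidsLemma ∣ a ∣ ∣ b ∣ prime[2] (subst (2 ℕᵈ.∣_) (ℤ.abs-* a b) (∣⇒∣ᵤ 2∣ab)))

odd-* : ∀ {a b} → Odd a → Odd b → Odd (a * b)
odd-* {a} {b} a-odd b-odd = [ a-odd , b-odd ]′ ∘ even-* a b

odd-1 : Odd 1ℤ
odd-1 (divides (+ 0)     ())
odd-1 (divides (+ suc _) ())
odd-1 (divides -[1+ _ ]  ())

odd≢0 : ∀ {a} → Odd a → a ≢ 0ℤ
odd≢0 a-odd refl = a-odd even-0

odd-1+2* : ∀ x → Odd (1ℤ + + 2 * x)
odd-1+2* x even = odd-1 (∣m+n∣n⇒∣m even (even-2* x))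

half : ∀ {x} → Even x → ∃ λ y → x ≡ + 2 * y
half (divides y x≡y*2) = y , trans x≡y*2 (ℤ.*-comm y (+ 2))

even-*-even⇒even-half : ∀ {a b c} → Even a → Even b → a * b ≡ + 2 * c → Even c
even-*-even⇒even-half {c = c} (divides x refl) (divides y refl) ab≡2c =
  divides (x * y) (ℤ.*-cancelˡ-≡ (+ 2) c _ (trans (sym ab≡2c) (regroup x y)))
  where
  regroup : ∀ x y → x * + 2 * (y * + 2) ≡ + 2 * (x * y * + 2)
  regroup = ℤSolver.solve-∀

2-adic-induction : (P : ℤ → Set) → (∀ {o} → Odd o → P o) → (∀ c → P c → P (+ 2 * c)) →
                   ∀ {c} → c ≢ 0ℤ → P c
2-adic-induction P base step {c} = go (<-wellFounded ∣ c ∣) c refl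
  where
  go : ∀ {n} → Acc _<_ n → ∀ c → ∣ c ∣ ≡ n → c ≢ 0ℤ → P c
  go (acc smaller) c refl c≢0 with even? c
  ... | no  c-odd  = base c-odd
  ... | yes c-even with half c-even
  ...   | c′ , refl = step c′ (go (smaller ∣c′∣<∣2c′∣) c′ refl c′≢0)
    where
    c′≢0 : c′ ≢ 0ℤ
    c′≢0 = c≢0 ∘ cong (+ 2 *_)
    ∣c′∣<∣2c′∣ : ∣ c′ ∣ < ∣ + 2 * c′ ∣
    ∣c′∣<∣2c′∣ = subst (∣ c′ ∣ <_) (sym (ℤ.abs-* (+ 2) c′))
      (ℕₚ.m<m+n ∣ c′ ∣ (ℕₚ.n≢0⇒n>0 (c′≢0 ∘ ℤ.∣i∣≡0⇒i≡0 ∘ trans (sym (ℕₚ.+-identityʳ _)))))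

record AllEven (p : ℤ[X]) : Set where
  constructor allEven
  field even-coeff : ∀ i → Even (coeffℤ p i)
open AllEven public

AllEven-resp-≈ : ∀ {p q} → p ≈ q → AllEven p → AllEven q
AllEven-resp-≈ p≈q (allEven ev) = allEven λ i → subst Even (coeff-≡ p≈q i) (ev i)

∷-allEven : ∀ {a p} → Even a → AllEven p → AllEven (a ∷ p)
∷-allEven a-even (allEven ev) = allEven λ { zero → a-even ; (suc i) → ev i }

[]⊗-allEven : ∀ {c} p → Even c → AllEven ([ c ] ⊗ p)
[]⊗-allEven {c} p c-even = allEven λ i → subst Even (sym (coeff-[]⊗ c p i)) (even-*ˡ _ c-even)

halve· : ∀ p → AllEven p → ∃ λ p′ → p ≈ + 2 · p′
halve· []      _  = [] , ≈-refl
halve· (a ∷ p) ev with half (even-coeff ev 0) | halve· p (allEven (even-coeff ev ∘ suc))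
... | a′ , refl | p′ , p≈2p′ = a′ ∷ p′ , ∷-cong refl p≈2p′

halve : ∀ p → AllEven p → ∃ λ p′ → p ≈ [ + 2 ] ⊗ p′
halve p ev = Product.map₂ (λ p≈2p′ → ≈-trans p≈2p′ (≈-sym ([]⊗≈· (+ 2) _))) (halve· p ev)

allEven-∷⊗ : ∀ {a} p q → Even a → AllEven ((a ∷ p) ⊗ q) → AllEven (p ⊗ q)
allEven-∷⊗ {a} p q a-even (allEven ev) = allEven λ i →
  even-+-cancelˡ (subst Even (coeff-∷⊗-suc a p q i) (ev (suc i))) (even-*ˡ _ a-even)

allEven-odd∷⊗ : ∀ {a} p q → Odd a → AllEven ((a ∷ p) ⊗ q) → AllEven q
allEven-odd∷⊗ p []      _     _  = allEven λ _ → even-0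
allEven-odd∷⊗ {a} p (b ∷ q) a-odd ev = ∷-allEven b-even (allEven-odd∷⊗ p q a-odd ev′)
  where
  b-even : Even b
  b-even = [ ⊥-elim ∘ a-odd , id ]′ (even-* a b (subst Even (coeff-∷⊗-zero a p (b ∷ q)) (even-coeff ev 0)))
  ev′ : AllEven ((a ∷ p) ⊗ q)
  ev′ = AllEven-resp-≈ (⊗-comm q (a ∷ p))
          (allEven-∷⊗ q (a ∷ p) b-even (AllEven-resp-≈ (⊗-comm (a ∷ p) (b ∷ q)) ev))

allEven-⊗ : ∀ p q → AllEven (p ⊗ q) → AllEven p ⊎ AllEven q
allEven-⊗ []      q _  = inj₁ (allEven λ _ → even-0)
allEven-⊗ (a ∷ p) q ev with even? a
... | no  a-odd  = inj₂ (allEven-odd∷⊗ p q a-odd ev)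
... | yes a-even = Sum.map₁ (∷-allEven a-even) (allEven-⊗ p q (allEven-∷⊗ p q a-even ev))

[]-*-⊗ : ∀ a b p → [ a * b ] ⊗ p ≈ [ a ] ⊗ ([ b ] ⊗ p)
[]-*-⊗ a b p = ≈-trans (⊗-congˡ p ([]-* a b)) (⊗-assoc [ a ] [ b ] p)

lower-even-cancelʳ : ∀ {d} q {N} → Odd (coeffℤ d 0) → (∀ i → i < N → Even (coeffℤ (q ⊗ d) i)) →
                ∀ i → i < N → Even (coeffℤ q i)
lower-even-cancelʳ []      _      _  _ _ = even-0
lower-even-cancelʳ (a ∷ q) {zero} _  _ _ ()
lower-even-cancelʳ {d} (a ∷ q) {suc N} d₀-odd ev = λ
  { zero    _         → a-even
  ; (suc i) (s≤s i<N) → lower-even-cancelʳ q d₀-odd ev′ i i<N }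
  where
  a-even : Even a
  a-even = [ id , ⊥-elim ∘ d₀-odd ]′ (even-* a _ (subst Even (coeff-∷⊗-zero a q d) (ev 0 (s≤s z≤n))))
  ev′ : ∀ j → j < N → Even (coeffℤ (q ⊗ d) j)
  ev′ j j<N = even-+-cancelˡ (subst Even (coeff-∷⊗-suc a q d j) (ev (suc j) (s≤s j<N))) (even-*ˡ _ a-even)

-- The normalisation of the constant term makes Eisenstein polynomials that
-- are associate in ℤ₍₂₎[X] equal.
record Eisenstein (f : ℤ[X]) (n : ℕ) : Set where
  field
    1≤degree    : 1 ≤ n
    constant≡2  : coeffℤ f 0 ≡ + 2
    lower-even  : ∀ i → i < n → Even (coeffℤ f i)
    leading-odd : Odd (coeffℤ f n)
    degreeBelow : DegreeBelow f (suc n)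

  exact-degree : HasDegree f n
  exact-degree = hasDegree (odd≢0 leading-odd) degreeBelow

  not-allEven : ¬ AllEven f
  not-allEven ev = leading-odd (even-coeff ev n)

module _ {f n} (E : Eisenstein f n) where
  open Eisenstein E

  -- Modulo 2, q d ≡ c f ≡ xⁿ; a factor with odd constant term is a unit
  -- modulo (2, xⁿ), which forces the other factor to have degree n.
  private
    cofactor-constant : ∀ {c q d a b} → [ c ] ⊗ f ≈ q ⊗ d → n ≡ a ℕ.+ b →
                        HasDegree q a → Odd (coeffℤ q a) → Odd (coeffℤ d 0) → b ≡ 0
    cofactor-constant {c} {q} {d} {a} {b} e n≡a+b hq qₐ-odd d₀-odd = no-room b n≡a+b
      where
      q-lower-even : ∀ i → i < n → Even (coeffℤ q i)
      q-lower-even = lower-even-cancelʳ q d₀-odd λ i i<n →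
        subst Even (trans (sym (coeff-[]⊗ c f i)) (coeff-≡ e i)) (even-*ʳ c (lower-even i i<n))
      n≤a : n ≤ a
      n≤a = ℕₚ.≮⇒≥ λ a<n → qₐ-odd (q-lower-even a a<n)
      no-room : ∀ b → n ≡ a ℕ.+ b → b ≡ 0
      no-room zero    _          = refl
      no-room (suc b) n≡a+1+b = ⊥-elim (ℕₚ.m+1+n≰m a (subst (_≤ a) n≡a+1+b n≤a))

  eisenstein-irreducible-odd : ∀ {c q d a b} → Odd c → [ c ] ⊗ f ≈ q ⊗ d →
                               HasDegree q a → HasDegree d b → a ≡ 0 ⊎ b ≡ 0
  eisenstein-irreducible-odd {c} {q} {d} {a} {b} c-odd e hq hd =
    cases (even? (coeffℤ q 0)) (even? (coeffℤ d 0))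
    where
    n≡a+b : n ≡ a ℕ.+ b
    n≡a+b = HasDegree-unique (HasDegree-resp-≈ e (HasDegree-⊗ ([]-hasDegree (odd≢0 c-odd)) exact-degree))
                             (HasDegree-⊗ hq hd)
    leading : Odd (coeffℤ q a * coeffℤ d b)
    leading = subst Odd (begin
      c * coeffℤ f n                 ≡⟨ coeff-[]⊗ c f n ⟨
      coeffℤ ([ c ] ⊗ f) n           ≡⟨ coeff-≡ e n ⟩
      coeffℤ (q ⊗ d) n               ≡⟨ cong (coeffℤ (q ⊗ d)) n≡a+b ⟩
      coeffℤ (q ⊗ d) (a ℕ.+ b)       ≡⟨ coeff-⊗-top (below hq) (below hd) ⟩
      coeffℤ q a * coeffℤ d b        ∎) (odd-* c-odd leading-odd)
      where open ≡-Reasoning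
    constant : coeffℤ q 0 * coeffℤ d 0 ≡ + 2 * c
    constant = begin
      coeffℤ q 0 * coeffℤ d 0        ≡⟨ coeff-⊗-zero q d ⟨
      coeffℤ (q ⊗ d) 0               ≡⟨ coeff-≡ e 0 ⟨
      coeffℤ ([ c ] ⊗ f) 0           ≡⟨ coeff-[]⊗ c f 0 ⟩
      c * coeffℤ f 0                 ≡⟨ cong (c *_) constant≡2 ⟩
      c * + 2                        ≡⟨ ℤ.*-comm c (+ 2) ⟩
      + 2 * c                        ∎
      where open ≡-Reasoning
    cases : Dec (Even (coeffℤ q 0)) → Dec (Even (coeffℤ d 0)) → a ≡ 0 ⊎ b ≡ 0
    cases _           (no d₀-odd) =
      inj₂ (cofactor-constant {c} e n≡a+b hq (leading ∘ even-*ˡ (coeffℤ d b)) d₀-odd)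
    cases (no q₀-odd) (yes _)     =
      inj₁ (cofactor-constant {c} (≈-trans e (⊗-comm q d)) (trans n≡a+b (ℕₚ.+-comm a b)) hd
                              (leading ∘ even-*ʳ (coeffℤ q a)) q₀-odd)
    cases (yes q₀-even) (yes d₀-even) = ⊥-elim (c-odd (even-*-even⇒even-half q₀-even d₀-even constant))

  eisenstein-irreducible : ∀ {c q d a b} → c ≢ 0ℤ → [ c ] ⊗ f ≈ q ⊗ d →
                           HasDegree q a → HasDegree d b → a ≡ 0 ⊎ b ≡ 0
  eisenstein-irreducible {c} c≢0 = 2-adic-induction P (λ o-odd → eisenstein-irreducible-odd o-odd) halve-factor c≢0
    where
    P : ℤ → Set
    P c = ∀ {q d a b} → [ c ] ⊗ f ≈ q ⊗ d → HasDegree q a → HasDegree d b → a ≡ 0 ⊎ b ≡ 0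
    halve-factor : ∀ c → P c → P (+ 2 * c)
    halve-factor c ih {q} {d} e hq hd with allEven-⊗ q d (AllEven-resp-≈ e ([]⊗-allEven f (even-2* c)))
    ... | inj₁ q-even with halve q q-even
    ...   | q′ , q≈2q′ = ih ([]⊗-cancel (+ 2) (λ ()) (begin
            [ + 2 ] ⊗ ([ c ] ⊗ f)   ≈⟨ []-*-⊗ (+ 2) c f ⟨
            [ + 2 * c ] ⊗ f         ≈⟨ e ⟩
            q ⊗ d                   ≈⟨ ⊗-congˡ d q≈2q′ ⟩
            [ + 2 ] ⊗ q′ ⊗ d        ≈⟨ ⊗-assoc [ + 2 ] q′ d ⟩
            [ + 2 ] ⊗ (q′ ⊗ d)      ∎))
          (HasDegree-[]⊗⁻ (+ 2) (λ ()) (HasDegree-resp-≈ q≈2q′ hq)) hd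
      where open ≈-Reasoning
    halve-factor c ih {q} {d} e hq hd | inj₂ d-even with halve d d-even
    ...   | d′ , d≈2d′ = ih ([]⊗-cancel (+ 2) (λ ()) (begin
            [ + 2 ] ⊗ ([ c ] ⊗ f)   ≈⟨ []-*-⊗ (+ 2) c f ⟨
            [ + 2 * c ] ⊗ f         ≈⟨ e ⟩
            q ⊗ d                   ≈⟨ ⊗-congʳ q d≈2d′ ⟩
            q ⊗ ([ + 2 ] ⊗ d′)      ≈⟨ ⊗-leftComm q [ + 2 ] d′ ⟩
            [ + 2 ] ⊗ (q ⊗ d′)      ∎))
          hq (HasDegree-[]⊗⁻ (+ 2) (λ ()) (HasDegree-resp-≈ d≈2d′ hd))
      where open ≈-Reasoning

-- Divisibility in ℤ₍₂₎[X], i.e. up to odd scalars.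

infix 4 _∣ₒ_

record _∣ₒ_ (f g : ℤ[X]) : Set where
  constructor divₒ
  field
    scalar     : ℤ
    scalar-odd : Odd scalar
    cofactor   : ℤ[X]
    equation   : [ scalar ] ⊗ g ≈ f ⊗ cofactor

∣ₒ-respʳ-≈ : ∀ {f g g′} → g ≈ g′ → f ∣ₒ g → f ∣ₒ g′
∣ₒ-respʳ-≈ g≈g′ (divₒ c c-odd u e) = divₒ c c-odd u (≈-trans (⊗-congʳ [ c ] (≈-sym g≈g′)) e)

∣ₒ-⊗ʳ : ∀ f h → f ∣ₒ f ⊗ h
∣ₒ-⊗ʳ f h = divₒ 1ℤ odd-1 h (⊗-identityˡ (f ⊗ h))

halve-cofactor : ∀ {f g u} → ¬ AllEven f → [ + 2 ] ⊗ g ≈ f ⊗ u → ∃ λ u′ → g ≈ f ⊗ u′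
halve-cofactor {f} {g} {u} f-not-even e with allEven-⊗ f u (AllEven-resp-≈ e ([]⊗-allEven g even-2))
... | inj₁ f-even = ⊥-elim (f-not-even f-even)
... | inj₂ u-even with halve u u-even
...   | u′ , u≈2u′ = u′ , []⊗-cancel (+ 2) (λ ()) (begin
        [ + 2 ] ⊗ g          ≈⟨ e ⟩
        f ⊗ u                ≈⟨ ⊗-congʳ f u≈2u′ ⟩
        f ⊗ ([ + 2 ] ⊗ u′)   ≈⟨ ⊗-leftComm f [ + 2 ] u′ ⟩
        [ + 2 ] ⊗ (f ⊗ u′)   ∎)
  where open ≈-Reasoning

scaled-divides⇒∣ₒ : ∀ {f g c u} → ¬ AllEven f → c ≢ 0ℤ → [ c ] ⊗ g ≈ f ⊗ u → f ∣ₒ g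
scaled-divides⇒∣ₒ {f} {g} f-not-even c≢0 e = 2-adic-induction P (λ c-odd → divₒ _ c-odd _) halve-scalar c≢0 e
  where
  P : ℤ → Set
  P c = ∀ {u} → [ c ] ⊗ g ≈ f ⊗ u → f ∣ₒ g
  halve-scalar : ∀ c → P c → P (+ 2 * c)
  halve-scalar c ih e = ih (proj₂ (halve-cofactor f-not-even (≈-trans (≈-sym ([]-*-⊗ (+ 2) c g)) e)))

eisenstein-∤ₒ-1 : ∀ {f n} → Eisenstein f n → ¬ f ∣ₒ [ 1ℤ ]
eisenstein-∤ₒ-1 {f} {n} E (divₒ c c-odd u e)
  with cofactor-degree f u (HasDegree-⊗ ([]-hasDegree (odd≢0 c-odd)) ([]-hasDegree (λ ())))
                        (Eisenstein.exact-degree E) e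
... | _ , _ , 0≡n+k = ℕₚ.n≮0 (subst (0 <_) (ℕₚ.m+n≡0⇒m≡0 n (sym 0≡n+k)) (Eisenstein.1≤degree E))

eisenstein-∣ₒ⇒≈ : ∀ {f g m n} → Eisenstein f m → Eisenstein g n → f ∣ₒ g → f ≈ g
eisenstein-∣ₒ⇒≈ {f} {g} Ef Eg (divₒ c c-odd u e)
  with cofactor-degree f u (HasDegree-⊗ ([]-hasDegree (odd≢0 c-odd)) (Eisenstein.exact-degree Eg))
                        (Eisenstein.exact-degree Ef) e
... | k , hu , _ with eisenstein-irreducible Eg (odd≢0 c-odd) e (Eisenstein.exact-degree Ef) hu
...   | inj₁ refl = ⊥-elim (ℕₚ.n≮0 (Eisenstein.1≤degree Ef))
...   | inj₂ refl = ≈-sym ([]⊗-cancel c (odd≢0 c-odd)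
                      (≈-trans e (≈-trans (⊗-congʳ f u≈c) (⊗-comm f [ c ]))))
  where
  open ≡-Reasoning
  u₀≡c : coeffℤ u 0 ≡ c
  u₀≡c = ℤ.*-cancelˡ-≡ (+ 2) _ _ (begin
    + 2 * coeffℤ u 0          ≡⟨ cong (_* coeffℤ u 0) (Eisenstein.constant≡2 Ef) ⟨
    coeffℤ f 0 * coeffℤ u 0   ≡⟨ coeff-⊗-zero f u ⟨
    coeffℤ (f ⊗ u) 0          ≡⟨ coeff-≡ e 0 ⟨
    coeffℤ ([ c ] ⊗ g) 0      ≡⟨ coeff-[]⊗ c g 0 ⟩
    c * coeffℤ g 0            ≡⟨ cong (c *_) (Eisenstein.constant≡2 Eg) ⟩
    c * + 2                   ≡⟨ ℤ.*-comm c (+ 2) ⟩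
    + 2 * c                   ∎)
  u≈c : u ≈ [ c ]
  u≈c = ≈-trans (HasDegree-zero hu) (∷-cong u₀≡c ≈-refl)

record PseudoDivision (p d : ℤ[X]) (m : ℕ) : Set where
  constructor pseudoDivision
  field
    multiplier      : ℤ
    multiplier≢0    : multiplier ≢ 0ℤ
    quotient        : ℤ[X]
    remainder       : ℤ[X]
    equation        : [ multiplier ] ⊗ p ≈ quotient ⊗ d ⊕ remainder
    remainder-below : DegreeBelow remainder m

eliminate-leading : ∀ {d p m j N} → HasDegree d m → m ℕ.+ j ≡ N → DegreeBelow p (suc N) →
  DegreeBelow ([ coeffℤ d m ] ⊗ p ⊕ ⊖ ([ coeffℤ p N ] ⊗ (d ⊗ x^ j))) N
eliminate-leading {d} {p} {m} {j} hd refl bp = DegreeBelow-pred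
  (DegreeBelow-⊕ (⊗-degreeBelow ([]-degreeBelow a) bp) (DegreeBelow-⊖ (⊗-degreeBelow ([]-degreeBelow b) bdxʲ)))
  (begin
    coeffℤ ([ a ] ⊗ p ⊕ ⊖ ([ b ] ⊗ dxʲ)) (m ℕ.+ j)
      ≡⟨ coeff-⊕ ([ a ] ⊗ p) (⊖ ([ b ] ⊗ dxʲ)) (m ℕ.+ j) ⟩
    coeffℤ ([ a ] ⊗ p) (m ℕ.+ j) + coeffℤ (⊖ ([ b ] ⊗ dxʲ)) (m ℕ.+ j)
      ≡⟨ cong₂ _+_ (coeff-[]⊗ a p (m ℕ.+ j))
                   (trans (coeff-⊖ ([ b ] ⊗ dxʲ) (m ℕ.+ j)) (cong -_ (coeff-[]⊗ b dxʲ (m ℕ.+ j)))) ⟩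
    a * b + - (b * coeffℤ dxʲ (m ℕ.+ j))
      ≡⟨ cong (λ z → a * b + - (b * z)) (trans (coeff-⊗-top (below hd) (x^-degreeBelow j))
                                               (cong (a *_) (coeff-x^-≡ j))) ⟩
    a * b + - (b * (a * 1ℤ))
      ≡⟨ cancel a b ⟩
    0ℤ
      ∎)
  where
  open ≡-Reasoning
  a b : ℤ
  a = coeffℤ d m
  b = coeffℤ p (m ℕ.+ j)
  dxʲ : ℤ[X]
  dxʲ = d ⊗ x^ j
  bdxʲ : DegreeBelow dxʲ (suc (m ℕ.+ j))
  bdxʲ = ⊗-degreeBelow (below hd) (x^-degreeBelow j)
  cancel : ∀ a b → a * b + - (b * (a * 1ℤ)) ≡ 0ℤ
  cancel = ℤSolver.solve-∀

pseudoDivide : ∀ {d m} → HasDegree d m → ∀ p → PseudoDivision p d m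
pseudoDivide {d} {m} hd p = go (length p) p (length-degreeBelow p)
  where
  go : ∀ N p → DegreeBelow p N → PseudoDivision p d m
  go N p bp with N ℕₚ.≤? m
  ... | yes N≤m = pseudoDivision 1ℤ (λ ()) [] p (⊗-identityˡ p)
                    (vanishing λ i m≤i → vanishes bp i (ℕₚ.≤-trans N≤m m≤i))
  go zero    p bp | no N≰m = ⊥-elim (N≰m z≤n)
  go (suc N) p bp | no N≰m with ℕₚ.m≤n⇒∃[o]m+o≡n (ℕₚ.≤-pred (ℕₚ.≰⇒> N≰m))
  ... | j , m+j≡N = reduce (go N p₁ (eliminate-leading hd m+j≡N bp))
    where
    a b : ℤ
    a = coeffℤ d m
    b = coeffℤ p N
    p₁ : ℤ[X]
    p₁ = [ a ] ⊗ p ⊕ ⊖ ([ b ] ⊗ (d ⊗ x^ j))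
    reduce : PseudoDivision p₁ d m → PseudoDivision p d m
    reduce (pseudoDivision c c≢0 q r e br) =
      pseudoDivision (c * a) (*-≢0 c≢0 (leading≢0 hd)) (q ⊕ [ c ] ⊗ ([ b ] ⊗ x^ j)) r (begin
        [ c * a ] ⊗ p                                   ≈⟨ []-*-⊗ c a p ⟩
        [ c ] ⊗ ([ a ] ⊗ p)                             ≈⟨ split [ c ] ([ a ] ⊗ p) [ b ] d (x^ j) ⟩
        [ c ] ⊗ p₁ ⊕ [ c ] ⊗ ([ b ] ⊗ x^ j) ⊗ d         ≈⟨ ⊕-cong e ≈-refl ⟩
        q ⊗ d ⊕ r ⊕ [ c ] ⊗ ([ b ] ⊗ x^ j) ⊗ d          ≈⟨ collect q d r ([ c ] ⊗ ([ b ] ⊗ x^ j)) ⟩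
        (q ⊕ [ c ] ⊗ ([ b ] ⊗ x^ j)) ⊗ d ⊕ r            ∎) br
      where
      open ≈-Reasoning
      split : ∀ c a b d x → c ⊗ a ≈ c ⊗ (a ⊕ ⊖ (b ⊗ (d ⊗ x))) ⊕ c ⊗ (b ⊗ x) ⊗ d
      split = solve-∀ ℤ[X]-almostCommutativeRing
      collect : ∀ q d r s → q ⊗ d ⊕ r ⊕ s ⊗ d ≈ (q ⊕ s) ⊗ d ⊕ r
      collect = solve-∀ ℤ[X]-almostCommutativeRing

∣ₒ-via-associate : ∀ {f g d c s c′ q′} → ¬ AllEven f → s ≢ 0ℤ → c′ ≢ 0ℤ →
                   [ c ] ⊗ f ≈ [ s ] ⊗ d → [ c′ ] ⊗ g ≈ q′ ⊗ d → f ∣ₒ g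
∣ₒ-via-associate {f} {g} {d} {c} {s} {c′} {q′} f-not-even s≢0 c′≢0 cf≈sd c′g≈q′d =
  scaled-divides⇒∣ₒ f-not-even (*-≢0 s≢0 c′≢0) (begin
    [ s * c′ ] ⊗ g          ≈⟨ []-*-⊗ s c′ g ⟩
    [ s ] ⊗ ([ c′ ] ⊗ g)    ≈⟨ ⊗-congʳ [ s ] c′g≈q′d ⟩
    [ s ] ⊗ (q′ ⊗ d)        ≈⟨ ⊗-leftComm [ s ] q′ d ⟩
    q′ ⊗ ([ s ] ⊗ d)        ≈⟨ ⊗-congʳ q′ (≈-sym cf≈sd) ⟩
    q′ ⊗ ([ c ] ⊗ f)        ≈⟨ rotate q′ [ c ] f ⟩
    f ⊗ (q′ ⊗ [ c ])        ∎)
  where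
  open ≈-Reasoning
  rotate : ∀ x y z → x ⊗ (y ⊗ z) ≈ z ⊗ (x ⊗ y)
  rotate = solve-∀ ℤ[X]-almostCommutativeRing

-- The ideal 𝓘 = {p | f ∣ₒ p h} contains f and g.  Euclid's algorithm inside 𝓘,
-- started at f, ends with a nonzero constant in 𝓘 (so f ∣ₒ h) or with an
-- element of 𝓘 associate to f, which then divides g.
module EisensteinPrime {f n} (E : Eisenstein f n) (g h : ℤ[X]) (f∣gh : f ∣ₒ g ⊗ h) where
  open Eisenstein E

  record 𝓘 (p : ℤ[X]) : Set where
    constructor in𝓘
    field divides-⊗h : f ∣ₒ p ⊗ h

  𝓘-resp-≈ : ∀ {p p′} → p ≈ p′ → 𝓘 p → 𝓘 p′
  𝓘-resp-≈ p≈p′ (in𝓘 f∣ph) = in𝓘 (∣ₒ-respʳ-≈ (⊗-congˡ h p≈p′) f∣ph)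

  𝓘-linear : ∀ a b {p q} → 𝓘 p → 𝓘 q → 𝓘 (a ⊗ p ⊕ b ⊗ q)
  𝓘-linear a b {p} {q} (in𝓘 (divₒ c₁ c₁-odd u₁ e₁)) (in𝓘 (divₒ c₂ c₂-odd u₂ e₂)) = in𝓘 $
    divₒ (c₁ * c₂) (odd-* c₁-odd c₂-odd) (a ⊗ [ c₂ ] ⊗ u₁ ⊕ b ⊗ [ c₁ ] ⊗ u₂) (begin
      [ c₁ * c₂ ] ⊗ ((a ⊗ p ⊕ b ⊗ q) ⊗ h)
        ≈⟨ []-*-⊗ c₁ c₂ _ ⟩
      [ c₁ ] ⊗ ([ c₂ ] ⊗ ((a ⊗ p ⊕ b ⊗ q) ⊗ h))
        ≈⟨ distribute a b [ c₁ ] [ c₂ ] p q h ⟩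
      a ⊗ [ c₂ ] ⊗ ([ c₁ ] ⊗ (p ⊗ h)) ⊕ b ⊗ [ c₁ ] ⊗ ([ c₂ ] ⊗ (q ⊗ h))
        ≈⟨ ⊕-cong (⊗-congʳ (a ⊗ [ c₂ ]) e₁) (⊗-congʳ (b ⊗ [ c₁ ]) e₂) ⟩
      a ⊗ [ c₂ ] ⊗ (f ⊗ u₁) ⊕ b ⊗ [ c₁ ] ⊗ (f ⊗ u₂)
        ≈⟨ factor (a ⊗ [ c₂ ]) (b ⊗ [ c₁ ]) f u₁ u₂ ⟩
      f ⊗ (a ⊗ [ c₂ ] ⊗ u₁ ⊕ b ⊗ [ c₁ ] ⊗ u₂)
        ∎)
    where
    open ≈-Reasoning
    distribute : ∀ a b c₁ c₂ p q h →
      c₁ ⊗ (c₂ ⊗ ((a ⊗ p ⊕ b ⊗ q) ⊗ h)) ≈ a ⊗ c₂ ⊗ (c₁ ⊗ (p ⊗ h)) ⊕ b ⊗ c₁ ⊗ (c₂ ⊗ (q ⊗ h))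
    distribute = solve-∀ ℤ[X]-almostCommutativeRing
    factor : ∀ x y f u v → x ⊗ (f ⊗ u) ⊕ y ⊗ (f ⊗ v) ≈ f ⊗ (x ⊗ u ⊕ y ⊗ v)
    factor = solve-∀ ℤ[X]-almostCommutativeRing

  𝓘-remainder : ∀ {c p q d r} → [ c ] ⊗ p ≈ q ⊗ d ⊕ r → 𝓘 p → 𝓘 d → 𝓘 r
  𝓘-remainder {c} {p} {q} {d} {r} e Ip Id =
    𝓘-resp-≈ (≈-trans (⊕-cong e ≈-refl) (cancel q d r)) (𝓘-linear [ c ] (⊖ q) Ip Id)
    where
    cancel : ∀ q d r → q ⊗ d ⊕ r ⊕ ⊖ q ⊗ d ≈ r
    cancel = solve-∀ ℤ[X]-almostCommutativeRing

  𝓘-constant : ∀ {m} → m ≢ 0ℤ → 𝓘 [ m ] → f ∣ₒ h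
  𝓘-constant {m} m≢0 (in𝓘 (divₒ c c-odd u e)) =
    scaled-divides⇒∣ₒ not-allEven (*-≢0 (odd≢0 c-odd) m≢0)
      (≈-trans ([]-*-⊗ c m h) e)

  Smaller : ℕ → Set
  Smaller m = ∃₂ λ j r → j < m × HasDegree r j × 𝓘 r

  divide-in-𝓘 : ∀ {d m p} → HasDegree d m → 𝓘 d → 𝓘 p →
                (∃₂ λ c q → c ≢ 0ℤ × [ c ] ⊗ p ≈ q ⊗ d) ⊎ Smaller m
  divide-in-𝓘 {p = p} hd Id Ip with pseudoDivide hd p
  ... | pseudoDivision c c≢0 q r e br with degree? r
  ...   | inj₁ r≈0      = inj₁ (c , q , c≢0 , ≈-trans e (≈-trans (⊕-cong ≈-refl r≈0) (⊕-identityʳ _)))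
  ...   | inj₂ (j , hr) = inj₂ (j , r , HasDegree⇒< br hr , hr , 𝓘-remainder {c} {q = q} e Ip Id)

  euclid-step : ∀ {d m} → HasDegree d m → 𝓘 d → (f ∣ₒ g ⊎ f ∣ₒ h) ⊎ Smaller m
  euclid-step {d} hd Id with divide-in-𝓘 hd Id (in𝓘 (∣ₒ-⊗ʳ f h))
  ... | inj₂ smaller = inj₂ smaller
  ... | inj₁ (c , q , c≢0 , cf≈qd)
    with cofactor-degree d q (HasDegree-⊗ ([]-hasDegree c≢0) exact-degree) hd (≈-trans cf≈qd (⊗-comm q d))
  ...   | _ , hq , _ with eisenstein-irreducible E c≢0 cf≈qd hq hd
  ...     | inj₂ refl = inj₁ (inj₂ (𝓘-constant (leading≢0 hd) (𝓘-resp-≈ (HasDegree-zero hd) Id)))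
  ...     | inj₁ refl with divide-in-𝓘 hd Id (in𝓘 f∣gh)
  ...       | inj₂ smaller = inj₂ smaller
  ...       | inj₁ (c′ , q′ , c′≢0 , c′g≈q′d) = inj₁ (inj₁
                (∣ₒ-via-associate {c = c} {c′ = c′} {q′} not-allEven (leading≢0 hq) c′≢0
                  (≈-trans cf≈qd (⊗-congˡ d (HasDegree-zero hq))) c′g≈q′d))

  euclid : ∀ {d m} → Acc _<_ m → HasDegree d m → 𝓘 d → f ∣ₒ g ⊎ f ∣ₒ h
  euclid (acc smaller) hd Id with euclid-step hd Id
  ... | inj₁ done                      = done
  ... | inj₂ (_ , _ , j<m , hr , Ir)   = euclid (smaller j<m) hr Ir

eisenstein-prime : ∀ {f n} → Eisenstein f n → ∀ g h → f ∣ₒ g ⊗ h → f ∣ₒ g ⊎ f ∣ₒ h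
eisenstein-prime {f} {n} E g h f∣gh =
  euclid (<-wellFounded n) (Eisenstein.exact-degree E) (in𝓘 (∣ₒ-⊗ʳ f h))
  where open EisensteinPrime E g h f∣gh

open import Algebra.Properties.CommutativeMonoid.Sum
  (CommutativeRing.*-commutativeMonoid ℤ[X]-commutativeRing)
  using () renaming (sum to ∏; sum-remove to ∏-remove; sum-permute to ∏-permute; sum-cong-≋ to ∏-cong)

∣ₒ-∏⇒≈ : ∀ {f m n} (g : Fin n → ℤ[X]) → Eisenstein f m → (∀ j → ∃ (Eisenstein (g j))) →
         f ∣ₒ ∏ g → ∃ λ j → f ≈ g j
∣ₒ-∏⇒≈ {n = zero}  g E Eg f∣∏g = ⊥-elim (eisenstein-∤ₒ-1 E f∣∏g)
∣ₒ-∏⇒≈ {n = suc n} g E Eg f∣∏g with eisenstein-prime E (g zero) (∏ (g ∘ suc)) f∣∏g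
... | inj₁ f∣g₀ = zero , eisenstein-∣ₒ⇒≈ E (proj₂ (Eg zero)) f∣g₀
... | inj₂ f∣∏g′ = Product.map suc id (∣ₒ-∏⇒≈ (g ∘ suc) E (Eg ∘ suc) f∣∏g′)

unique-factorisation : ∀ {m n} (f : Fin m → ℤ[X]) (g : Fin n → ℤ[X]) →
                       (∀ i → ∃ (Eisenstein (f i))) → (∀ j → ∃ (Eisenstein (g j))) → ∏ f ≈ ∏ g →
                       Σ (Permutation m n) λ σ → ∀ i → f i ≈ g (σ ⟨$⟩ʳ i)
unique-factorisation {zero} {zero} f g Ef Eg ∏f≈∏g = Perm.id , λ ()
unique-factorisation {zero} {suc n} f g Ef Eg ∏f≈∏g =
  ⊥-elim (eisenstein-∤ₒ-1 (proj₂ (Eg zero)) (∣ₒ-respʳ-≈ (≈-sym ∏f≈∏g) (∣ₒ-⊗ʳ (g zero) (∏ (g ∘ suc)))))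
unique-factorisation {suc m} {n} f g Ef Eg ∏f≈∏g
  with ∣ₒ-∏⇒≈ g (proj₂ (Ef zero)) Eg (∣ₒ-respʳ-≈ ∏f≈∏g (∣ₒ-⊗ʳ (f zero) (∏ (f ∘ suc))))
unique-factorisation {suc m} {suc n} f g Ef Eg ∏f≈∏g | j , f₀≈gⱼ = σ , matched
  where
  rest : ∏ (f ∘ suc) ≈ ∏ (removeAt g j)
  rest = ⊗-cancelˡ (Eisenstein.exact-degree (proj₂ (Ef zero)))
           (≈-trans ∏f≈∏g (≈-trans (∏-remove {i = j} g) (⊗-congˡ _ (≈-sym f₀≈gⱼ))))
  IH : Σ (Permutation m n) λ π → ∀ i → f (suc i) ≈ removeAt g j (π ⟨$⟩ʳ i)
  IH = unique-factorisation (f ∘ suc) (removeAt g j) (Ef ∘ suc) (Eg ∘ punchIn j) rest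
  σ : Permutation (suc m) (suc n)
  σ = Perm.insert zero j (proj₁ IH)
  matched : ∀ i → f i ≈ g (σ ⟨$⟩ʳ i)
  matched zero    = f₀≈gⱼ
  matched (suc i) = subst (λ k → f (suc i) ≈ g k) (sym (Perm.insert-punchIn zero j (proj₁ IH) i)) (proj₂ IH i)

toℤ[X] : Poly → ℤ[X]
toℤ[X] = map (λ n → + n)

coeff-toℤ[X] : ∀ p i → coeffℤ (toℤ[X] p) i ≡ + coeff p i
coeff-toℤ[X] []      i       = refl
coeff-toℤ[X] (a ∷ p) zero    = refl
coeff-toℤ[X] (a ∷ p) (suc i) = coeff-toℤ[X] p i

toℤ[X]-+ : ∀ p q → toℤ[X] (p +P q) ≡ toℤ[X] p ⊕ toℤ[X] q
toℤ[X]-+ []      q       = refl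
toℤ[X]-+ (a ∷ p) []      = refl
toℤ[X]-+ (a ∷ p) (b ∷ q) = cong (+ (a ℕ.+ b) ∷_) (toℤ[X]-+ p q)

toℤ[X]-scale : ∀ c p → toℤ[X] (scale c p) ≡ + c · toℤ[X] p
toℤ[X]-scale c []      = refl
toℤ[X]-scale c (a ∷ p) = cong₂ _∷_ (ℤ.pos-* c a) (toℤ[X]-scale c p)

toℤ[X]-* : ∀ p q → toℤ[X] (p *P q) ≡ toℤ[X] p ⊗ toℤ[X] q
toℤ[X]-* []      q = refl
toℤ[X]-* (a ∷ p) q = trans (toℤ[X]-+ (scale a q) (0 ∷ p *P q))
                           (cong₂ _⊕_ (toℤ[X]-scale a q) (cong (0ℤ ∷_) (toℤ[X]-* p q)))

toℤ[X]-xpow : ∀ n → toℤ[X] (xpow n) ≡ x^ n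
toℤ[X]-xpow zero    = refl
toℤ[X]-xpow (suc n) = cong (0ℤ ∷_) (toℤ[X]-xpow n)

≈P⇒≈ : ∀ {p q} → p ≈P q → toℤ[X] p ≈ toℤ[X] q
≈P⇒≈ {p} {q} e = coeffwise λ i → trans (coeff-toℤ[X] p i) (trans (cong (λ n → + n) (e i)) (sym (coeff-toℤ[X] q i)))

≈⇒≈P : ∀ {p q} → toℤ[X] p ≈ toℤ[X] q → p ≈P q
≈⇒≈P {p} {q} e i = ℤ.+-injective (trans (sym (coeff-toℤ[X] p i)) (trans (coeff-≡ e i) (coeff-toℤ[X] q i)))

nodePoly : ℕ → ℤ[X] → ℤ[X]
nodePoly s P = x^ suc s ⊕ [ + 2 ] ⊗ x^ 1 ⊗ P ⊕ [ + 2 ]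

Cℤ : Tree → ℤ[X]
Cℤ t = toℤ[X] (C t)

Πℤ : List Tree → ℤ[X]
Πℤ cs = toℤ[X] (prodC cs)

Πℤ-∷ : ∀ c cs → Πℤ (c ∷ cs) ≡ Cℤ c ⊗ Πℤ cs
Πℤ-∷ c cs = toℤ[X]-* (C c) (prodC cs)

Cℤ-node : ∀ c cs → Cℤ (node (c ∷ cs)) ≡ nodePoly (sizes (c ∷ cs)) (Πℤ (c ∷ cs))
Cℤ-node c cs = begin
  toℤ[X] (xpow n +P constP 2 *P X *P prodC (c ∷ cs) +P constP 2)
    ≡⟨ toℤ[X]-+ (xpow n +P constP 2 *P X *P prodC (c ∷ cs)) (constP 2) ⟩
  toℤ[X] (xpow n +P constP 2 *P X *P prodC (c ∷ cs)) ⊕ [ + 2 ]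
    ≡⟨ cong (_⊕ [ + 2 ]) (toℤ[X]-+ (xpow n) (constP 2 *P X *P prodC (c ∷ cs))) ⟩
  toℤ[X] (xpow n) ⊕ toℤ[X] (constP 2 *P X *P prodC (c ∷ cs)) ⊕ [ + 2 ]
    ≡⟨ cong₂ (λ x y → x ⊕ y ⊕ [ + 2 ]) (toℤ[X]-xpow n) (toℤ[X]-* (constP 2 *P X) (prodC (c ∷ cs))) ⟩
  nodePoly (sizes (c ∷ cs)) (Πℤ (c ∷ cs)) ∎
  where
  open ≡-Reasoning
  n : ℕ
  n = size (node (c ∷ cs))

coeff-2x⊗-zero : ∀ P → coeffℤ ([ + 2 ] ⊗ x^ 1 ⊗ P) 0 ≡ 0ℤ
coeff-2x⊗-zero P = trans (coeff-∷⊗-zero 0ℤ [ + 2 ] P) (ℤ.*-zeroˡ (coeffℤ P 0))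

coeff-2x⊗-suc : ∀ P i → coeffℤ ([ + 2 ] ⊗ x^ 1 ⊗ P) (suc i) ≡ + 2 * coeffℤ P i
coeff-2x⊗-suc P i = trans (coeff-∷⊗-suc 0ℤ [ + 2 ] P i) (trans (ℤ.+-identityˡ _) (coeff-[]⊗ (+ 2) P i))

eisenstein-nodePoly : ∀ {s P} → DegreeBelow P (suc s) → Eisenstein (nodePoly s P) (suc s)
eisenstein-nodePoly {s} {P} bP = record
  { 1≤degree    = s≤s z≤n
  ; constant≡2  = trans (coeff-nodePoly 0) (cong (λ z → 0ℤ + z + + 2) (coeff-2x⊗-zero P))
  ; lower-even  = λ i i<n → subst Even (sym (coeff-nodePoly i))
                    (even-+ (even-+ (subst Even (sym (coeff-x^-< i<n)) even-0) (even-coeff 2x⊗P-even i)) (2-even i))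
  ; leading-odd = subst Odd (sym (trans (coeff-nodePoly (suc s))
                    (cong₂ (λ x y → x + y + 0ℤ) (coeff-x^-≡ s) (coeff-2x⊗-suc P s))))
                    (odd-1+2* (coeffℤ P s) ∘ subst Even (ℤ.+-identityʳ _))
  ; degreeBelow = DegreeBelow-⊕ (DegreeBelow-⊕ (x^-degreeBelow (suc s))
                    (⊗-degreeBelow (⊗-degreeBelow ([]-degreeBelow (+ 2)) (x^-degreeBelow 1)) bP))
                    (DegreeBelow-mono (s≤s z≤n) ([]-degreeBelow (+ 2)))
  }
  where
  coeff-nodePoly : ∀ i → coeffℤ (nodePoly s P) i
                         ≡ coeffℤ (x^ suc s) i + coeffℤ ([ + 2 ] ⊗ x^ 1 ⊗ P) i + coeffℤ [ + 2 ] i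
  coeff-nodePoly i = trans (coeff-⊕ (x^ suc s ⊕ [ + 2 ] ⊗ x^ 1 ⊗ P) [ + 2 ] i)
                           (cong (_+ coeffℤ [ + 2 ] i) (coeff-⊕ (x^ suc s) ([ + 2 ] ⊗ x^ 1 ⊗ P) i))
  2x⊗P≈2⊗xP : [ + 2 ] ⊗ x^ 1 ⊗ P ≈ [ + 2 ] ⊗ (x^ 1 ⊗ P)
  2x⊗P≈2⊗xP = ⊗-assoc [ + 2 ] (x^ 1) P
  2x⊗P-even : AllEven ([ + 2 ] ⊗ x^ 1 ⊗ P)
  2x⊗P-even = AllEven-resp-≈ (≈-sym 2x⊗P≈2⊗xP) ([]⊗-allEven (x^ 1 ⊗ P) even-2)
  2-even : ∀ i → Even (coeffℤ [ + 2 ] i)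
  2-even zero    = even-2
  2-even (suc i) = even-0

leaf-eisenstein : Eisenstein (Cℤ (node [])) 1
leaf-eisenstein = record
  { 1≤degree    = s≤s z≤n
  ; constant≡2  = refl
  ; lower-even  = λ { zero _ → even-2 ; (suc _) (s≤s ()) }
  ; leading-odd = odd-1
  ; degreeBelow = vanishing λ { (suc (suc i)) _ → refl ; (suc zero) (s≤s ()) }
  }

mutual
  Cℤ-eisenstein : ∀ t → Eisenstein (Cℤ t) (size t)
  Cℤ-eisenstein (node [])       = leaf-eisenstein
  Cℤ-eisenstein (node (c ∷ cs)) = subst (λ F → Eisenstein F (size (node (c ∷ cs)))) (sym (Cℤ-node c cs))
                                        (eisenstein-nodePoly (below (Πℤ-hasDegree (c ∷ cs))))

  Πℤ-hasDegree : ∀ cs → HasDegree (Πℤ cs) (sizes cs)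
  Πℤ-hasDegree []       = []-hasDegree (λ ())
  Πℤ-hasDegree (c ∷ cs) = subst (λ P → HasDegree P (sizes (c ∷ cs))) (sym (Πℤ-∷ c cs))
                                (HasDegree-⊗ (Eisenstein.exact-degree (Cℤ-eisenstein c)) (Πℤ-hasDegree cs))

Πℤ-∏ : ∀ cs → Πℤ cs ≈ ∏ (Cℤ ∘ lookup cs)
Πℤ-∏ []       = ≈-refl
Πℤ-∏ (c ∷ cs) = ≈-trans (≈-reflexive (Πℤ-∷ c cs)) (⊗-congʳ (Cℤ c) (Πℤ-∏ cs))

Cℤ≈⇒size≡ : ∀ T T′ → Cℤ T ≈ Cℤ T′ → size T ≡ size T′
Cℤ≈⇒size≡ T T′ e = HasDegree-unique (HasDegree-resp-≈ e (Eisenstein.exact-degree (Cℤ-eisenstein T)))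
                                     (Eisenstein.exact-degree (Cℤ-eisenstein T′))

nodePoly-cong : ∀ {s s′ P P′} → s ≡ s′ → P ≈ P′ → nodePoly s P ≈ nodePoly s′ P′
nodePoly-cong {s} refl P≈P′ =
  ⊕-cong (⊕-cong (≈-refl {x^ suc s}) (⊗-congʳ ([ + 2 ] ⊗ x^ 1) P≈P′)) (≈-refl {[ + 2 ]})

nodePoly-injectiveʳ : ∀ {s P P′} → nodePoly s P ≈ nodePoly s P′ → P ≈ P′
nodePoly-injectiveʳ {s} {P} {P′} e = ⊗-cancelˡ (HasDegree-⊗ ([]-hasDegree {+ 2} (λ ())) (x^-hasDegree 1)) (begin
  [ + 2 ] ⊗ x^ 1 ⊗ P                        ≈⟨ isolate (x^ suc s) ([ + 2 ] ⊗ x^ 1 ⊗ P) [ + 2 ] ⟩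
  nodePoly s P ⊕ ⊖ x^ suc s ⊕ ⊖ [ + 2 ]     ≈⟨ ⊕-cong (⊕-cong e ≈-refl) ≈-refl ⟩
  nodePoly s P′ ⊕ ⊖ x^ suc s ⊕ ⊖ [ + 2 ]    ≈⟨ isolate (x^ suc s) ([ + 2 ] ⊗ x^ 1 ⊗ P′) [ + 2 ] ⟨
  [ + 2 ] ⊗ x^ 1 ⊗ P′                       ∎)
  where
  open ≈-Reasoning
  isolate : ∀ a x b → x ≈ a ⊕ x ⊕ b ⊕ ⊖ a ⊕ ⊖ b
  isolate = solve-∀ ℤ[X]-almostCommutativeRing

Cℤ-node⇒Πℤ≈ : ∀ c cs d ds → Cℤ (node (c ∷ cs)) ≈ Cℤ (node (d ∷ ds)) → Πℤ (c ∷ cs) ≈ Πℤ (d ∷ ds)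
Cℤ-node⇒Πℤ≈ c cs d ds e = nodePoly-injectiveʳ (begin
  nodePoly (sizes (c ∷ cs)) (Πℤ (c ∷ cs))   ≡⟨ Cℤ-node c cs ⟨
  Cℤ (node (c ∷ cs))                        ≈⟨ e ⟩
  Cℤ (node (d ∷ ds))                        ≡⟨ Cℤ-node d ds ⟩
  nodePoly (sizes (d ∷ ds)) (Πℤ (d ∷ ds))   ≡⟨ cong (λ s → nodePoly s (Πℤ (d ∷ ds))) sizes≡ ⟨
  nodePoly (sizes (c ∷ cs)) (Πℤ (d ∷ ds))   ∎)
  where
  open ≈-Reasoning
  sizes≡ : sizes (c ∷ cs) ≡ sizes (d ∷ ds)
  sizes≡ = ℕₚ.suc-injective (Cℤ≈⇒size≡ (node (c ∷ cs)) (node (d ∷ ds)) e)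

mutual
  Cℤ≈⇒≅ : ∀ T T′ → Cℤ T ≈ Cℤ T′ → T ≅ T′
  Cℤ≈⇒≅ (node [])       (node [])                 _ = iso Perm.id (λ ())
  Cℤ≈⇒≅ (node [])       T′@(node (node _ ∷ _))    e with Cℤ≈⇒size≡ (node []) T′ e
  ... | ()
  Cℤ≈⇒≅ T@(node (node _ ∷ _)) (node [])           e with Cℤ≈⇒size≡ T (node []) e
  ... | ()
  Cℤ≈⇒≅ (node (c ∷ cs)) (node (d ∷ ds))         e = iso (proj₁ factors) λ i →
    children-≅ (c ∷ cs) i (lookup (d ∷ ds) (proj₁ factors ⟨$⟩ʳ i)) (proj₂ factors i)
    where
    factors : Σ (Permutation (length (c ∷ cs)) (length (d ∷ ds))) λ σ →
                ∀ i → Cℤ (lookup (c ∷ cs) i) ≈ Cℤ (lookup (d ∷ ds) (σ ⟨$⟩ʳ i))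
    factors = unique-factorisation (Cℤ ∘ lookup (c ∷ cs)) (Cℤ ∘ lookup (d ∷ ds))
                (λ i → _ , Cℤ-eisenstein (lookup (c ∷ cs) i)) (λ j → _ , Cℤ-eisenstein (lookup (d ∷ ds) j))
                (≈-trans (≈-sym (Πℤ-∏ (c ∷ cs))) (≈-trans (Cℤ-node⇒Πℤ≈ c cs d ds e) (Πℤ-∏ (d ∷ ds))))

  -- Recursing along the list of children keeps the recursion structural.
  children-≅ : ∀ cs (i : Fin (length cs)) T′ → Cℤ (lookup cs i) ≈ Cℤ T′ → lookup cs i ≅ T′
  children-≅ (c ∷ cs) zero    T′ = Cℤ≈⇒≅ c T′
  children-≅ (c ∷ cs) (suc i) T′ = children-≅ cs i T′

Cℤ-node-cong : ∀ cs ds (σ : Fin (length cs) ↔ Fin (length ds)) →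
            (∀ i → Cℤ (lookup cs i) ≈ Cℤ (lookup ds (Inverse.to σ i))) → Cℤ (node cs) ≈ Cℤ (node ds)
Cℤ-node-cong []       []       σ _ = ≈-refl
Cℤ-node-cong []       (d ∷ ds) σ _ with Inverse.from σ zero
... | ()
Cℤ-node-cong (c ∷ cs) []       σ _ with Inverse.to σ zero
... | ()
Cℤ-node-cong (c ∷ cs) (d ∷ ds) σ children≈ = begin
  Cℤ (node (c ∷ cs))                        ≡⟨ Cℤ-node c cs ⟩
  nodePoly (sizes (c ∷ cs)) (Πℤ (c ∷ cs))   ≈⟨ nodePoly-cong sizes≡ Π≈Π ⟩
  nodePoly (sizes (d ∷ ds)) (Πℤ (d ∷ ds))   ≡⟨ Cℤ-node d ds ⟨
  Cℤ (node (d ∷ ds))                        ∎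
  where
  open ≈-Reasoning
  Π≈Π : Πℤ (c ∷ cs) ≈ Πℤ (d ∷ ds)
  Π≈Π = begin
    Πℤ (c ∷ cs)                                       ≈⟨ Πℤ-∏ (c ∷ cs) ⟩
    ∏ (Cℤ ∘ lookup (c ∷ cs))                          ≈⟨ ∏-cong children≈ ⟩
    ∏ (λ i → Cℤ (lookup (d ∷ ds) (Inverse.to σ i)))   ≈⟨ ∏-permute (Cℤ ∘ lookup (d ∷ ds)) σ ⟨
    ∏ (Cℤ ∘ lookup (d ∷ ds))                          ≈⟨ Πℤ-∏ (d ∷ ds) ⟨
    Πℤ (d ∷ ds)                                       ∎
  sizes≡ : sizes (c ∷ cs) ≡ sizes (d ∷ ds)
  sizes≡ = HasDegree-unique (HasDegree-resp-≈ Π≈Π (Πℤ-hasDegree (c ∷ cs))) (Πℤ-hasDegree (d ∷ ds))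

≅⇒Cℤ≈ : ∀ {T T′} → T ≅ T′ → Cℤ T ≈ Cℤ T′
≅⇒Cℤ≈ (iso {cs} {ds} σ children≅) = Cℤ-node-cong cs ds σ (λ i → ≅⇒Cℤ≈ (children≅ i))

mainTheorem3 : (T T′ : Tree) → ((C-T T ≈P C-T T′) → T ≅ T′) × (T ≅ T′ → C-T T ≈P C-T T′)
mainTheorem3 T T′ = (λ C≈C′ → Cℤ≈⇒≅ T T′ (≈P⇒≈ C≈C′)) , (λ T≅T′ → ≈⇒≈P (≅⇒Cℤ≈ T≅T′))
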